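{- Let $X\subseteq\mathrm{PVAR}$ be finite, $\alpha\ge|X|$, and let $\varphi,\psi$ be satisfiable core types in $\mathrm{Type}(X,\alpha)$. Then the formulae $(\mathrm{Box}_{\circledast}(\varphi,\psi)\ast\varphi)\Rightarrow\psi$ and $((\neg\mathrm{Box}_{\circledast}(\varphi,\psi))\ast\varphi)\Rightarrow\neg\psi$ are valid.
   Context: Syntax of $\mathrm{SL}(\ast,\mathrel{ -\!\!\ast})$: fix a countably infinite set $\mathrm{PVAR}$ of program variables and a countably infinite set $\mathrm{LOC}$ of locations. Formulae: $\varphi ::= x = y \mid x \hookrightarrow y \mid \mathrm{emp} \mid \neg\varphi \mid \varphi\wedge\varphi \mid \varphi \ast \varphi \mid \varphi \mathrel{ -\!\!\ast} \varphi$ ($x,y\in\mathrm{PVAR}$). Memory states $(s,h)$: $s:\mathrm{PVAR}\to\mathrm{LOC}$, $h$ a partial function $\mathrm{LOC}\to\mathrm{LOC}$ with finite domain. $(s,h)\models x=y$ iff $s(x)=s(y)$; $\models\mathrm{emp}$ iff $\mathrm{dom}(h)=\emptyset$; $\models x\hookrightarrow y$ iff $s(x)\in\mathrm{dom}(h)$ and $h(s(x))=s(y)$; Boolean connectives as usual; $\models\varphi_1\ast\varphi_2$ iff there are domain-disjoint $h_1,h_2$ with $h=h_1+h_2$ and $(s,h_i)\models\varphi_i$; $\models\varphi_1\mathrel{ -\!\!\ast}\varphi_2$ iff for every $h_1$ with domain disjoint from $\mathrm{dom}(h)$ and $(s,h_1)\models\varphi_1$, $(s,h+h_1)\models\varphi_2$.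 Valid = satisfied by every memory state; satisfiable = satisfied by some. Abbreviations: $\bot:=\neg(x=x)$, $\top:=\neg\bot$, $\mathrm{alloc}(x):=(x\hookrightarrow x)\mathrel{ -\!\!\ast}\bot$ (holds iff $s(x)\in\mathrm{dom}(h)$), $\mathrm{size}\ge0:=\top$, $\mathrm{size}\ge1:=\neg\mathrm{emp}$, $\mathrm{size}\ge\beta:=\neg\mathrm{emp}\ast\mathrm{size}\ge\beta-1$ for $\beta\ge2$ (holds iff $|\mathrm{dom}(h)|\ge\beta$); $a\dot-b=\max(0,a-b)$. Core formulae: $\mathrm{Core}(X,\alpha)=\{x=y,\ \mathrm{alloc}(x),\ x\hookrightarrow y,\ \mathrm{size}\ge\beta : x,y\in X,\ \beta\in[0,\alpha]\}$; a literal is a core formula or its negation. A core type in $\mathrm{Type}(X,\alpha)$ is a conjunction of literals over $\mathrm{Core}(X,\alpha)$ in which, for each $\psi\in\mathrm{Core}(X,\alpha)$, exactly one of $\psi,\neg\psi$ occurs as a conjunct. "$L$ occurs in $\varphi$" means $L$ is a conjunct of $\varphi$. $\mathrm{Box}_{\circledast}(\varphi,\psi)$ is the conjunction of: every literal $x=y$ or $\neg(x=y)$ occurring in $\varphi$ or in $\psi$; $\mathrm{alloc}(x)$ whenever $\neg\mathrm{alloc}(x)$ occurs in $\varphi$ and $\mathrm{alloc}(x)$ occurs in $\psi$; every $\neg\mathrm{alloc}(x)$ occurring in $\psi$; $\neg\mathrm{alloc}(x)$ whenever $\mathrm{alloc}(x)$ occurs in $\varphi$; every $\neg x\hookrightarrow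 y$ occurring in $\psi$; $x\hookrightarrow y$ whenever $\neg\mathrm{alloc}(x)$ occurs in $\varphi$ and $x\hookrightarrow y$ occurs in $\psi$; $\neg(x=x)$ whenever $\mathrm{alloc}(x)$ and $\neg x\hookrightarrow y$ occur in $\varphi$ and $x\hookrightarrow y$ occurs in $\psi$; $\neg(x=x)$ whenever $x\hookrightarrow y$ occurs in $\varphi$ and $\neg x\hookrightarrow y$ occurs in $\psi$; $\neg(x=x)$ whenever $\mathrm{alloc}(x)$ occurs in $\varphi$ and $\neg\mathrm{alloc}(x)$ occurs in $\psi$; $\mathrm{size}\ge\beta_2+1\dot-\beta_1$ whenever $\neg\,\mathrm{size}\ge\beta_1$ occurs in $\varphi$ and $\mathrm{size}\ge\beta_2$ occurs in $\psi$; $\neg\,\mathrm{size}\ge\beta_2\dot-\beta_1$ whenever $\mathrm{size}\ge\beta_1$ occurs in $\varphi$ and $\neg\,\mathrm{size}\ge\beta_2$ occurs in $\psi$. -}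

module Defs where

open import Data.Nat using (ℕ; zero; suc; _+_; _∸_; _≤_)
open import Data.Bool using (Bool; true; false; if_then_else_; not; _∧_)
open import Data.Maybe using (Maybe; just; nothing)
open import Data.List using (List; []; _∷_; _++_; map; concatMap; upTo)
open import Data.Product using (Σ; _×_; _,_)
open import Data.Sum using (_⊎_)
open import Relation.Nullary using (¬_)
open import Relation.Binary.PropositionalEquality using (_≡_)

-- Program variables and locations are both modelled by ℕ
-- (countably infinite sets).

PVAR : Set
PVAR = ℕ

LOC : Set
LOC = ℕ

infix 40 ¬ᶠ_
infixr 30 _∧ᶠ_
infixr 25 _∗_
infixr 20 _-∗_

data Form : Set where
  _≐_   : PVAR → PVAR → Form
  _↪_   : PVAR → PVAR → Form
  emp   : Form
  ¬ᶠ_   : Form → Form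
  _∧ᶠ_  : Form → Form → Form
  _∗_   : Form → Form → Form
  _-∗_  : Form → Form → Form

Store : Set
Store = PVAR → LOC

record Heap : Set where
  field
    fn    : LOC → Maybe LOC
    bound : ℕ
    fin   : ∀ l → bound ≤ l → fn l ≡ nothing
open Heap public

Disjoint : Heap → Heap → Set
Disjoint h₁ h₂ = ∀ l → fn h₁ l ≡ nothing ⊎ fn h₂ l ≡ nothing

unionM : Maybe LOC → Maybe LOC → Maybe LOC
unionM (just v) _ = just v
unionM nothing  m = m

Union : Heap → Heap → Heap → Set
Union h₁ h₂ h = Disjoint h₁ h₂ × (∀ l → fn h l ≡ unionM (fn h₁ l) (fn h₂ l))

_,_⊨_ : Store → Heap → Form → Set
s , h ⊨ (x ≐ y)   = s x ≡ s y
s , h ⊨ (x ↪ y)   = fn h (s x) ≡ just (s y)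
s , h ⊨ emp       = ∀ l → fn h l ≡ nothing
s , h ⊨ (¬ᶠ φ)    = ¬ (s , h ⊨ φ)
s , h ⊨ (φ ∧ᶠ ψ)  = (s , h ⊨ φ) × (s , h ⊨ ψ)
s , h ⊨ (φ ∗ ψ)   = Σ Heap λ h₁ → Σ Heap λ h₂ →
                      Union h₁ h₂ h × (s , h₁ ⊨ φ) × (s , h₂ ⊨ ψ)
s , h ⊨ (φ -∗ ψ)  = (h₁ : Heap) → Disjoint h h₁ → (s , h₁ ⊨ φ) →
                      (h' : Heap) → Union h h₁ h' → (s , h' ⊨ ψ)

Valid : Form → Set
Valid φ = (s : Store) (h : Heap) → s , h ⊨ φ

Satisfiable : Form → Set
Satisfiable φ = Σ Store λ s → Σ Heap λ h → s , h ⊨ φ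

-- ⊥ := ¬(x = x); we fix the variable x to be 0 in general
⊥ᶠ : Form
⊥ᶠ = ¬ᶠ (0 ≐ 0)

⊤ᶠ : Form
⊤ᶠ = ¬ᶠ ⊥ᶠ

_⇒_ : Form → Form → Form
φ ⇒ ψ = ¬ᶠ (φ ∧ᶠ ¬ᶠ ψ)

alloc : PVAR → Form
alloc x = (x ↪ x) -∗ ⊥ᶠ

size≥ : ℕ → Form
size≥ zero          = ⊤ᶠ
size≥ (suc zero)    = ¬ᶠ emp
size≥ (suc (suc β)) = ¬ᶠ emp ∗ size≥ (suc β)

⋀ : List Form → Form
⋀ []       = ⊤ᶠ
⋀ (φ ∷ []) = φ
⋀ (φ ∷ φs) = φ ∧ᶠ ⋀ φs

data Core : Set where
  ceq    : PVAR → PVAR → Core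
  calloc : PVAR → Core
  cpto   : PVAR → PVAR → Core
  csize  : ℕ → Core

⟦_⟧ᶜ : Core → Form
⟦ ceq x y  ⟧ᶜ = x ≐ y
⟦ calloc x ⟧ᶜ = alloc x
⟦ cpto x y ⟧ᶜ = x ↪ y
⟦ csize β  ⟧ᶜ = size≥ β

lit : Bool → Core → Form
lit true  c = ⟦ c ⟧ᶜ
lit false c = ¬ᶠ ⟦ c ⟧ᶜ

coreList : List PVAR → ℕ → List Core
coreList X α =
     concatMap (λ x → map (ceq x) X) X
  ++ map calloc X
  ++ concatMap (λ x → map (cpto x) X) X
  ++ map csize (upTo (suc α))

-- A core type in Type(X, α) is determined by choosing, for each
-- ψ ∈ Core(X, α), which of ψ / ¬ψ occurs.  τ c = true means the
-- literal c occurs, τ c = false means ¬c occurs (values of τ outside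
-- Core(X, α) are irrelevant).
TypeChoice : Set
TypeChoice = Core → Bool

typeForm : List PVAR → ℕ → TypeChoice → Form
typeForm X α τ = ⋀ (map (λ c → lit (τ c) c) (coreList X α))

opt : Bool → Form → List Form
opt b φ = if b then φ ∷ [] else []

boxLits : List PVAR → ℕ → TypeChoice → TypeChoice → List Form
boxLits X α φ ψ =
     concatMap (λ x → concatMap (λ y →
         lit (φ (ceq x y)) (ceq x y) ∷ lit (ψ (ceq x y)) (ceq x y) ∷ []) X) X
  ++ concatMap (λ x →
          opt (not (φ (calloc x)) ∧ ψ (calloc x)) (alloc x)
       ++ opt (not (ψ (calloc x))) (¬ᶠ alloc x)
       ++ opt (φ (calloc x)) (¬ᶠ alloc x)
       ++ opt (φ (calloc x) ∧ not (ψ (calloc x))) (¬ᶠ (x ≐ x))) X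
  ++ concatMap (λ x → concatMap (λ y →
          opt (not (ψ (cpto x y))) (¬ᶠ (x ↪ y))
       ++ opt (not (φ (calloc x)) ∧ ψ (cpto x y)) (x ↪ y)
       ++ opt (φ (calloc x) ∧ not (φ (cpto x y)) ∧ ψ (cpto x y)) (¬ᶠ (x ≐ x))
       ++ opt (φ (cpto x y) ∧ not (ψ (cpto x y))) (¬ᶠ (x ≐ x))) X) X
  ++ concatMap (λ β₁ → concatMap (λ β₂ →
          opt (not (φ (csize β₁)) ∧ ψ (csize β₂)) (size≥ (β₂ + 1 ∸ β₁))
       ++ opt (φ (csize β₁) ∧ not (ψ (csize β₂))) (¬ᶠ size≥ (β₂ ∸ β₁)))
       (upTo (suc α))) (upTo (suc α))

Box⊛ : List PVAR → ℕ → TypeChoice → TypeChoice → Form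
Box⊛ X α φ ψ = ⋀ (boxLits X α φ ψ)

module Submission where

-- Every literal of a core type, and every literal of Box⊛(φ, ψ), has a
-- direct semantic reading: equalities of the store, allocation and contents of
-- a location, and lower bounds on the number of cells of the heap.  Under a
-- disjoint union h = h₁ + h₂ these readings for h are determined by those for
-- h₁ and h₂ (allocation is a disjoint "or", sizes add up).  Box⊛(φ, ψ) is
-- precisely the list of conditions on h₁ that, given the φ-readings on h₂,
-- make the ψ-readings hold on h.

open import Defs
open import Data.Nat using (ℕ; zero; suc; _+_; _∸_; _≤_; _<_; z≤n; s≤s; s≤s⁻¹; _≟_; _<?_; _≤?_)
open import Data.Nat.Properties
open import Algebra.Properties.CommutativeSemigroup +-commutativeSemigroup using (interchange)
open import Data.Bool using (Bool; true; false; not; _∧_)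
open import Data.Maybe using (Maybe; just; nothing)
open import Data.List using (List; []; _∷_; _++_; map; concatMap; upTo; length)
open import Data.List.Relation.Unary.All as All using (All; []; _∷_; tabulate; lookup)
open import Data.List.Relation.Unary.All.Properties using (map⁺; map⁻; ++⁺; ++⁻ˡ; ++⁻ʳ; concat⁺; concat⁻)
open import Data.List.Membership.Propositional using (_∈_)
open import Data.List.Membership.Propositional.Properties using (∈-upTo⁺; ∈-upTo⁻)
open import Data.List.Relation.Unary.Unique.Propositional using (Unique)
open import Data.Product using (∃; _×_; _,_; proj₁; proj₂)
open import Data.Sum using (_⊎_; inj₁; inj₂; [_,_]′)
open import Data.Empty using (⊥-elim)
open import Function using (_∘_)
open import Function.Bundles using (_⇔_; mk⇔; Equivalence)
open import Relation.Nullary using (¬_; yes; no)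
open import Relation.Binary.PropositionalEquality

open Equivalence using (to; from)

Free : Heap → LOC → Set
Free h l = fn h l ≡ nothing

Allocated : Heap → LOC → Set
Allocated h l = ¬ Free h l

just-allocated : ∀ {h l v} → fn h l ≡ just v → Allocated h l
just-allocated p free with () ← trans (sym p) free

¬allocated⇒free : ∀ {h l} → ¬ Allocated h l → Free h l
¬allocated⇒free {h} {l} notAllocated with fn h l
... | nothing = refl
... | just _ = ⊥-elim (notAllocated λ ())

unionM-nothingʳ : ∀ m → unionM m nothing ≡ m
unionM-nothingʳ nothing  = refl
unionM-nothingʳ (just _) = refl

module UnionFacts {h₁ h₂ h : Heap} (u : Union h₁ h₂ h) where

  fromLeft : ∀ {l v} → fn h₁ l ≡ just v → fn h l ≡ just v
  fromLeft {l} p = trans (proj₂ u l) (cong (λ m → unionM m (fn h₂ l)) p)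

  freeLeft : ∀ {l} → Free h₁ l → fn h l ≡ fn h₂ l
  freeLeft {l} f = trans (proj₂ u l) (cong (λ m → unionM m (fn h₂ l)) f)

  freeRight : ∀ {l} → Free h₂ l → fn h l ≡ fn h₁ l
  freeRight {l} f = trans (proj₂ u l) (trans (cong (unionM (fn h₁ l)) f) (unionM-nothingʳ _))

  disjointRight : ∀ {l} → Allocated h₂ l → Free h₁ l
  disjointRight {l} a = [ (λ f → f) , (λ f → ⊥-elim (a f)) ]′ (proj₁ u l)

  fromRight : ∀ {l v} → fn h₂ l ≡ just v → fn h l ≡ just v
  fromRight p = trans (freeLeft (disjointRight (just-allocated {h₂} p))) p

  freeBoth : ∀ {l} → Free h₁ l → Free h₂ l → Free h l
  freeBoth f₁ f₂ = trans (freeLeft f₁) f₂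

  allocatedLeft : ∀ {l} → Allocated h₁ l → Allocated h l
  allocatedLeft {l} a f = a (trans (sym (freeRight f₂)) f)
    where
    f₂ : Free h₂ l
    f₂ = ¬allocated⇒free {h₂} (λ a₂ → a (disjointRight a₂))

  allocatedRight : ∀ {l} → Allocated h₂ l → Allocated h l
  allocatedRight {l} a f = a (trans (sym (freeLeft (disjointRight a))) f)

  viaRight : ∀ {l v} → Allocated h₂ l → fn h l ≡ just v → fn h₂ l ≡ just v
  viaRight a p = trans (sym (freeLeft (disjointRight a))) p

  viaLeft : ∀ {l v} → ¬ Allocated h₂ l → fn h l ≡ just v → fn h₁ l ≡ just v
  viaLeft ¬a p = trans (sym (freeRight (¬allocated⇒free {h₂} ¬a))) p

singleton : LOC → LOC → Heap
fn (singleton l v) m with m ≟ l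
... | yes _ = just v
... | no _  = nothing
bound (singleton l v) = suc l
fin (singleton l v) m l<m with m ≟ l
... | yes refl = ⊥-elim (n≮n m l<m)
... | no _     = refl

singleton-at : ∀ l v → fn (singleton l v) l ≡ just v
singleton-at l v with l ≟ l
... | yes _ = refl
... | no l≢l = ⊥-elim (l≢l refl)

_⊕_ : Heap → Heap → Heap
fn (h ⊕ g) m = unionM (fn h m) (fn g m)
bound (h ⊕ g) = bound h + bound g
fin (h ⊕ g) m b≤m
  rewrite fin h m (≤-trans (m≤m+n (bound h) (bound g)) b≤m)
        | fin g m (≤-trans (m≤n+m (bound g) (bound h)) b≤m) = refl

cell : LOC → Heap → Heap
fn (cell l h) m with m ≟ l
... | yes _ = fn h m
... | no _  = nothing
bound (cell l h) = bound h
fin (cell l h) m b≤m with m ≟ l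
... | yes _ = fin h m b≤m
... | no _  = refl

erase : LOC → Heap → Heap
fn (erase l h) m with m ≟ l
... | yes _ = nothing
... | no _  = fn h m
bound (erase l h) = bound h
fin (erase l h) m b≤m with m ≟ l
... | yes _ = refl
... | no _  = fin h m b≤m

cell-at : ∀ l h → fn (cell l h) l ≡ fn h l
cell-at l h with l ≟ l
... | yes _ = refl
... | no l≢l = ⊥-elim (l≢l refl)

cell-only : ∀ l h m → m ≢ l → Free (cell l h) m
cell-only l h m m≢l with m ≟ l
... | yes m≡l = ⊥-elim (m≢l m≡l)
... | no _    = refl

cell⊕erase : ∀ l h → Union (cell l h) (erase l h) h
cell⊕erase l h = disjoint , agree
  where
  disjoint : Disjoint (cell l h) (erase l h)
  disjoint m with m ≟ l
  ... | yes _ = inj₂ refl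
  ... | no _  = inj₁ refl
  agree : ∀ m → fn h m ≡ unionM (fn (cell l h) m) (fn (erase l h) m)
  agree m with m ≟ l
  ... | yes _ = sym (unionM-nothingʳ (fn h m))
  ... | no _  = refl

occupancy : Maybe LOC → ℕ
occupancy nothing  = 0
occupancy (just _) = 1

sizeBelow : ℕ → Heap → ℕ
sizeBelow zero    h = 0
sizeBelow (suc n) h = sizeBelow n h + occupancy (fn h n)

size : Heap → ℕ
size h = sizeBelow (bound h) h

sizeBelow-stable : ∀ h {n} → bound h ≤ n → sizeBelow n h ≡ size h
sizeBelow-stable h {n} b≤n =
  subst (λ m → sizeBelow m h ≡ size h) (m+[n∸m]≡n b≤n) (beyond (n ∸ bound h))
  where
  open ≡-Reasoning
  beyond : ∀ k → sizeBelow (bound h + k) h ≡ size h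
  beyond zero = cong (λ m → sizeBelow m h) (+-identityʳ (bound h))
  beyond (suc k) = begin
    sizeBelow (bound h + suc k) h
      ≡⟨ cong (λ m → sizeBelow m h) (+-suc (bound h) k) ⟩
    sizeBelow (bound h + k) h + occupancy (fn h (bound h + k))
      ≡⟨ cong (λ o → sizeBelow (bound h + k) h + occupancy o) (fin h _ (m≤m+n (bound h) k)) ⟩
    sizeBelow (bound h + k) h + 0
      ≡⟨ +-identityʳ _ ⟩
    sizeBelow (bound h + k) h
      ≡⟨ beyond k ⟩
    size h ∎

occupancy-union : ∀ a b → a ≡ nothing ⊎ b ≡ nothing →
                  occupancy (unionM a b) ≡ occupancy a + occupancy b
occupancy-union nothing  b        _         = refl
occupancy-union (just _) nothing  _         = refl
occupancy-union (just _) (just _) (inj₁ ())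
occupancy-union (just _) (just _) (inj₂ ())

size-union : ∀ {h₁ h₂ h} → Union h₁ h₂ h → size h ≡ size h₁ + size h₂
size-union {h₁} {h₂} {h} (disjoint , agree) = begin
  size h                            ≡⟨ sym (sizeBelow-stable h (m≤m+n (bound h) _)) ⟩
  sizeBelow N h                     ≡⟨ below N ⟩
  sizeBelow N h₁ + sizeBelow N h₂   ≡⟨ cong₂ _+_ (sizeBelow-stable h₁ b₁≤N) (sizeBelow-stable h₂ b₂≤N) ⟩
  size h₁ + size h₂                 ∎
  where
  open ≡-Reasoning
  N = bound h + (bound h₁ + bound h₂)
  b₁≤N : bound h₁ ≤ N
  b₁≤N = ≤-trans (m≤m+n (bound h₁) (bound h₂)) (m≤n+m _ (bound h))
  b₂≤N : bound h₂ ≤ N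
  b₂≤N = ≤-trans (m≤n+m (bound h₂) (bound h₁)) (m≤n+m _ (bound h))
  below : ∀ n → sizeBelow n h ≡ sizeBelow n h₁ + sizeBelow n h₂
  below zero = refl
  below (suc n) = begin
    sizeBelow n h + occupancy (fn h n)
      ≡⟨ cong₂ _+_ (below n) (cong occupancy (agree n)) ⟩
    (sizeBelow n h₁ + sizeBelow n h₂) + occupancy (unionM (fn h₁ n) (fn h₂ n))
      ≡⟨ cong (sizeBelow n h₁ + sizeBelow n h₂ +_) (occupancy-union (fn h₁ n) (fn h₂ n) (disjoint n)) ⟩
    (sizeBelow n h₁ + sizeBelow n h₂) + (occupancy (fn h₁ n) + occupancy (fn h₂ n))
      ≡⟨ interchange (sizeBelow n h₁) (sizeBelow n h₂) (occupancy (fn h₁ n)) (occupancy (fn h₂ n)) ⟩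
    sizeBelow (suc n) h₁ + sizeBelow (suc n) h₂ ∎

empty⇒size≡0 : ∀ {h} → (∀ l → Free h l) → size h ≡ 0
empty⇒size≡0 {h} empty = below (bound h)
  where
  below : ∀ n → sizeBelow n h ≡ 0
  below zero = refl
  below (suc n) rewrite empty n | below n = refl

size≡0⇒empty : ∀ {h} → size h ≡ 0 → ∀ l → Free h l
size≡0⇒empty {h} size≡0 l with l <? bound h
... | yes l<b = below (bound h) size≡0 l<b
  where
  below : ∀ n → sizeBelow n h ≡ 0 → l < n → Free h l
  below (suc n) ≡0 l<1+n with m<1+n⇒m<n∨m≡n l<1+n
  ... | inj₁ l<n  = below n (m+n≡0⇒m≡0 _ ≡0) l<n
  ... | inj₂ refl with fn h l | m+n≡0⇒n≡0 (sizeBelow n h) ≡0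
  ...   | nothing | _  = refl
  ...   | just _  | ()
... | no l≮b = fin h l (≮⇒≥ l≮b)

positive⇒allocated : ∀ {h} → 1 ≤ size h → ∃ λ l → Allocated h l
positive⇒allocated {h} = below (bound h)
  where
  below : ∀ n → 1 ≤ sizeBelow n h → ∃ λ l → Allocated h l
  below (suc n) pos with fn h n in eq
  ... | just _  = n , just-allocated {h} eq
  ... | nothing = below n (subst (1 ≤_) (+-identityʳ _) pos)

size-atMostOne : ∀ {g} l → (∀ m → m ≢ l → Free g m) → size g ≤ 1
size-atMostOne {g} l outside = proj₂ (below (bound g))
  where
  occupancy≤1 : ∀ v → occupancy v ≤ 1
  occupancy≤1 nothing  = z≤n
  occupancy≤1 (just _) = s≤s z≤n
  below : ∀ n → (n ≤ l → sizeBelow n g ≡ 0) × sizeBelow n g ≤ 1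
  below zero = (λ _ → refl) , z≤n
  below (suc n) with n ≟ l | below n
  ... | yes refl | none , _ =
    (λ 1+l≤l → ⊥-elim (n≮n n 1+l≤l)) ,
    subst (λ k → k + occupancy (fn g n) ≤ 1) (sym (none ≤-refl)) (occupancy≤1 (fn g n))
  ... | no n≢l | none , atMostOne rewrite outside n n≢l | +-identityʳ (sizeBelow n g) =
    (λ 1+n≤l → none (<⇒≤ 1+n≤l)) , atMostOne

size-erase : ∀ l h → size h ≤ suc (size (erase l h))
size-erase l h = begin
  size h                            ≡⟨ size-union {cell l h} {erase l h} {h} (cell⊕erase l h) ⟩
  size (cell l h) + size (erase l h) ≤⟨ +-monoˡ-≤ (size (erase l h)) (size-atMostOne {cell l h} l (cell-only l h)) ⟩
  suc (size (erase l h))            ∎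
  where open ≤-Reasoning

-- The semantics of alloc x: the location of x is allocated.  A free location
-- could be filled by the cell x ↦ x, which alloc x forbids.
alloc-sound : ∀ {s h} x → s , h ⊨ alloc x → Allocated h (s x)
alloc-sound {s} {h} x noExtension free =
  noExtension (singleton l l) disjoint (singleton-at l l) (h ⊕ singleton l l) (disjoint , λ _ → refl) refl
  where
  l = s x
  disjoint : Disjoint h (singleton l l)
  disjoint m with m ≟ l
  ... | yes refl = inj₁ free
  ... | no _     = inj₂ refl

alloc-complete : ∀ {s h} x → Allocated h (s x) → s , h ⊨ alloc x
alloc-complete {s} x allocated h₁ disjoint x↪x _ _ =
  ⊥-elim ([ allocated , just-allocated {h₁} x↪x ]′ (disjoint (s x)))

size-sound : ∀ {s h} β → s , h ⊨ size≥ β → β ≤ size h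
size-sound zero _ = z≤n
size-sound {h = h} (suc zero) nonEmpty with size h in size≡
... | zero  = ⊥-elim (nonEmpty (size≡0⇒empty {h} size≡))
... | suc _ = s≤s z≤n
size-sound {s} {h} (suc (suc β)) (h₁ , h₂ , u , nonEmpty , rest) =
  subst (suc (suc β) ≤_) (sym (size-union {h₁} {h₂} {h} u))
        (+-mono-≤ (size-sound {s} {h₁} 1 nonEmpty) (size-sound {s} {h₂} (suc β) rest))

size-complete : ∀ {s h} β → β ≤ size h → s , h ⊨ size≥ β
size-complete zero _ = λ absurd → absurd refl
size-complete {h = h} (suc zero) pos empty with () ← subst (1 ≤_) (empty⇒size≡0 {h} empty) pos
size-complete {h = h} (suc (suc β)) le =
  cell l h , erase l h , cell⊕erase l h ,
  (λ empty → allocated (trans (sym (cell-at l h)) (empty l))) ,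
  size-complete (suc β) (s≤s⁻¹ (≤-trans le (size-erase l h)))
  where
  l = proj₁ (positive⇒allocated {h} (≤-trans (s≤s z≤n) le))
  allocated = proj₂ (positive⇒allocated {h} (≤-trans (s≤s z≤n) le))

⟪_⟫ : Core → Store → Heap → Set
⟪ ceq x y  ⟫ s h = s x ≡ s y
⟪ calloc x ⟫ s h = Allocated h (s x)
⟪ cpto x y ⟫ s h = fn h (s x) ≡ just (s y)
⟪ csize β  ⟫ s h = β ≤ size h

Pol : Bool → Set → Set
Pol true  P = P
Pol false P = ¬ P

core⇔ : ∀ {s h} c → s , h ⊨ ⟦ c ⟧ᶜ ⇔ ⟪ c ⟫ s h
core⇔ (ceq x y)  = mk⇔ (λ p → p) (λ p → p)
core⇔ {s} {h} (calloc x) = mk⇔ (alloc-sound {s} {h} x) (alloc-complete {s} {h} x)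
core⇔ (cpto x y) = mk⇔ (λ p → p) (λ p → p)
core⇔ {s} {h} (csize β)  = mk⇔ (size-sound {s} {h} β) (size-complete {s} {h} β)

lit⇔ : ∀ {s h} b c → s , h ⊨ lit b c ⇔ Pol b (⟪ c ⟫ s h)
lit⇔ true  c = core⇔ c
lit⇔ {s} {h} false c =
  mk⇔ (λ ¬p q → ¬p (from (core⇔ {s} {h} c) q)) (λ ¬q p → ¬q (to (core⇔ {s} {h} c) p))

Sat : Store → Heap → Form → Set
Sat s h L = s , h ⊨ L

⋀⇔All : ∀ {s h} Ls → s , h ⊨ ⋀ Ls ⇔ All (Sat s h) Ls
⋀⇔All {s} {h} Ls = mk⇔ (split Ls) (join Ls)
  where
  split : ∀ Ls → s , h ⊨ ⋀ Ls → All (Sat s h) Ls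
  split []            _        = []
  split (L ∷ [])      p        = p ∷ []
  split (L ∷ L′ ∷ Ls) (p , ps) = p ∷ split (L′ ∷ Ls) ps
  join : ∀ Ls → All (Sat s h) Ls → s , h ⊨ ⋀ Ls
  join []            []       = λ absurd → absurd refl
  join (L ∷ [])      (p ∷ []) = p
  join (L ∷ L′ ∷ Ls) (p ∷ ps) = p , join (L′ ∷ Ls) ps

module _ {A B : Set} {P : B → Set} {f : A → B} {xs : List A} where

  lookup-map : All P (map f xs) → ∀ {x} → x ∈ xs → P (f x)
  lookup-map all = lookup (map⁻ all)

  tabulate-map : (∀ {x} → x ∈ xs → P (f x)) → All P (map f xs)
  tabulate-map each = map⁺ (tabulate each)

module _ {A B : Set} {P : B → Set} {f : A → List B} {xs : List A} where

  lookup-concatMap : All P (concatMap f xs) → ∀ {x} → x ∈ xs → All P (f x)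
  lookup-concatMap all = lookup (map⁻ (concat⁻ all))

  tabulate-concatMap : (∀ {x} → x ∈ xs → All P (f x)) → All P (concatMap f xs)
  tabulate-concatMap each = concat⁺ (map⁺ (tabulate each))

∈-upTo⇔ : ∀ {α β} → β ∈ upTo (suc α) ⇔ β ≤ α
∈-upTo⇔ = mk⇔ (s≤s⁻¹ ∘ ∈-upTo⁻) (∈-upTo⁺ ∘ s≤s)

eqCores : List PVAR → List Core
eqCores X = concatMap (λ x → map (ceq x) X) X

allocCores : List PVAR → List Core
allocCores X = map calloc X

ptoCores : List PVAR → List Core
ptoCores X = concatMap (λ x → map (cpto x) X) X

record CoreWise (X : List PVAR) (α : ℕ) (P : Core → Set) : Set where
  field
    atEq    : ∀ {x y} → x ∈ X → y ∈ X → P (ceq x y)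
    atAlloc : ∀ {x} → x ∈ X → P (calloc x)
    atPto   : ∀ {x y} → x ∈ X → y ∈ X → P (cpto x y)
    atSize  : ∀ {β} → β ≤ α → P (csize β)

coreWise⇔ : ∀ X α {P : Core → Set} → All P (coreList X α) ⇔ CoreWise X α P
coreWise⇔ X α {P} = mk⇔ split join
  where
  split : All P (coreList X α) → CoreWise X α P
  split all = record
    { atEq    = λ x∈ → lookup-map (lookup-concatMap eqs x∈)
    ; atAlloc = lookup-map allocs
    ; atPto   = λ x∈ → lookup-map (lookup-concatMap ptos x∈)
    ; atSize  = lookup-map sizes ∘ from ∈-upTo⇔
    }
    where
    eqs    = ++⁻ˡ (eqCores X) all
    allocs = ++⁻ˡ (allocCores X) (++⁻ʳ (eqCores X) all)
    ptos   = ++⁻ˡ (ptoCores X) (++⁻ʳ (allocCores X) (++⁻ʳ (eqCores X) all))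
    sizes  = ++⁻ʳ (ptoCores X) (++⁻ʳ (allocCores X) (++⁻ʳ (eqCores X) all))
  join : CoreWise X α P → All P (coreList X α)
  join cw =
    ++⁺ (tabulate-concatMap (λ x∈ → tabulate-map (atEq x∈))) (
    ++⁺ (tabulate-map atAlloc) (
    ++⁺ (tabulate-concatMap (λ x∈ → tabulate-map (atPto x∈)))
        (tabulate-map (atSize ∘ to ∈-upTo⇔))))
    where open CoreWise cw

Holds : TypeChoice → Store → Heap → Core → Set
Holds τ s h c = Pol (τ c) (⟪ c ⟫ s h)

TypeHolds : List PVAR → ℕ → TypeChoice → Store → Heap → Set
TypeHolds X α τ s h = CoreWise X α (Holds τ s h)

typeForm⇔ : ∀ X α τ s h → s , h ⊨ typeForm X α τ ⇔ TypeHolds X α τ s h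
typeForm⇔ X α τ s h = mk⇔
  (to (coreWise⇔ X α) ∘ All.map (λ {c} → to (lit⇔ {s} {h} (τ c) c)) ∘ map⁻ ∘ to (⋀⇔All _))
  (from (⋀⇔All _) ∘ map⁺ ∘ All.map (λ {c} → from (lit⇔ {s} {h} (τ c) c)) ∘ from (coreWise⇔ X α))

-- The arguments are the
-- polarities chosen by φ and ψ; "⊥" conjuncts appear as ¬ (x ≐ x).

eqLits : Bool → Bool → PVAR → PVAR → List Form
eqLits a b x y = lit a (ceq x y) ∷ lit b (ceq x y) ∷ []

allocLits : Bool → Bool → PVAR → List Form
allocLits a b x =
     opt (not a ∧ b) (alloc x) ++ opt (not b) (¬ᶠ alloc x)
  ++ opt a (¬ᶠ alloc x) ++ opt (a ∧ not b) (¬ᶠ (x ≐ x))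

ptoLits : Bool → Bool → Bool → PVAR → PVAR → List Form
ptoLits a p q x y =
     opt (not q) (¬ᶠ (x ↪ y)) ++ opt (not a ∧ q) (x ↪ y)
  ++ opt (a ∧ not p ∧ q) (¬ᶠ (x ≐ x)) ++ opt (p ∧ not q) (¬ᶠ (x ≐ x))

sizeLits : Bool → Bool → ℕ → ℕ → List Form
sizeLits a b β₁ β₂ =
  opt (not a ∧ b) (size≥ (β₂ + 1 ∸ β₁)) ++ opt (a ∧ not b) (¬ᶠ size≥ (β₂ ∸ β₁))

record BoxHolds (X : List PVAR) (α : ℕ) (φ ψ : TypeChoice) (s : Store) (h : Heap) : Set where
  field
    eqBox    : ∀ {x y} → x ∈ X → y ∈ X →
               All (Sat s h) (eqLits (φ (ceq x y)) (ψ (ceq x y)) x y)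
    allocBox : ∀ {x} → x ∈ X →
               All (Sat s h) (allocLits (φ (calloc x)) (ψ (calloc x)) x)
    ptoBox   : ∀ {x y} → x ∈ X → y ∈ X →
               All (Sat s h) (ptoLits (φ (calloc x)) (φ (cpto x y)) (ψ (cpto x y)) x y)
    sizeBox  : ∀ {β₁ β₂} → β₁ ≤ α → β₂ ≤ α →
               All (Sat s h) (sizeLits (φ (csize β₁)) (ψ (csize β₂)) β₁ β₂)

Box⊛⇔ : ∀ X α φ ψ s h → s , h ⊨ Box⊛ X α φ ψ ⇔ BoxHolds X α φ ψ s h
Box⊛⇔ X α φ ψ s h = mk⇔ (split ∘ to (⋀⇔All _)) (from (⋀⇔All _) ∘ join)
  where
  Up = upTo (suc α)
  eqPart    = concatMap (λ x → concatMap (λ y → eqLits (φ (ceq x y)) (ψ (ceq x y)) x y) X) X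
  allocPart = concatMap (λ x → allocLits (φ (calloc x)) (ψ (calloc x)) x) X
  ptoPart   = concatMap (λ x → concatMap (λ y →
                ptoLits (φ (calloc x)) (φ (cpto x y)) (ψ (cpto x y)) x y) X) X

  split : All (Sat s h) (boxLits X α φ ψ) → BoxHolds X α φ ψ s h
  split all = record
    { eqBox    = λ x∈ → lookup-concatMap (lookup-concatMap eqs x∈)
    ; allocBox = lookup-concatMap allocs
    ; ptoBox   = λ x∈ → lookup-concatMap (lookup-concatMap ptos x∈)
    ; sizeBox  = λ β₁≤ β₂≤ →
        lookup-concatMap (lookup-concatMap sizes (from ∈-upTo⇔ β₁≤)) (from ∈-upTo⇔ β₂≤)
    }
    where
    eqs    = ++⁻ˡ eqPart all
    allocs = ++⁻ˡ allocPart (++⁻ʳ eqPart all)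
    ptos   = ++⁻ˡ ptoPart (++⁻ʳ allocPart (++⁻ʳ eqPart all))
    sizes  = ++⁻ʳ ptoPart (++⁻ʳ allocPart (++⁻ʳ eqPart all))

  join : BoxHolds X α φ ψ s h → All (Sat s h) (boxLits X α φ ψ)
  join bh =
    ++⁺ (tabulate-concatMap (λ x∈ → tabulate-concatMap (eqBox x∈))) (
    ++⁺ (tabulate-concatMap allocBox) (
    ++⁺ (tabulate-concatMap (λ x∈ → tabulate-concatMap (ptoBox x∈)))
        (tabulate-concatMap (λ β₁∈ → tabulate-concatMap (λ β₂∈ →
           sizeBox (to ∈-upTo⇔ β₁∈) (to ∈-upTo⇔ β₂∈))))))
    where open BoxHolds bh

-- Arithmetic behind the size groups: with n₁ + n₂ cells in total and n₂ of
-- them in h₂, a lower bound β₂ on the total translates into the lower bound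
-- β₂ ∸ n₂ on n₁, and conversely.

deficit-≤ : ∀ {n₁ n₂ β₁ β₂} → n₂ < β₁ → β₂ ≤ n₁ + n₂ → β₂ + 1 ∸ β₁ ≤ n₁
deficit-≤ {n₁} {n₂} {β₁} {β₂} n₂<β₁ β₂≤n = begin
  β₂ + 1 ∸ β₁      ≤⟨ ∸-monoʳ-≤ (β₂ + 1) n₂<β₁ ⟩
  β₂ + 1 ∸ suc n₂  ≡⟨ cong (_∸ suc n₂) (+-comm β₂ 1) ⟩
  β₂ ∸ n₂          ≤⟨ m≤n+o⇒m∸n≤o β₂ n₂ (subst (β₂ ≤_) (+-comm n₁ n₂) β₂≤n) ⟩
  n₁               ∎
  where open ≤-Reasoning

split-≤ : ∀ {n₁ n₂ β₁ β₂} → β₁ ≤ n₂ → β₂ ∸ β₁ ≤ n₁ → β₂ ≤ n₁ + n₂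
split-≤ {n₁} {n₂} {β₁} {β₂} β₁≤n₂ rest≤n₁ = begin
  β₂               ≤⟨ m≤n+m∸n β₂ β₁ ⟩
  β₁ + (β₂ ∸ β₁)   ≤⟨ +-mono-≤ β₁≤n₂ rest≤n₁ ⟩
  n₂ + n₁          ≡⟨ +-comm n₂ n₁ ⟩
  n₁ + n₂          ∎
  where open ≤-Reasoning

module Extension (s : Store) {h₁ h₂ h : Heap} (u : Union h₁ h₂ h) where
  open UnionFacts {h₁} {h₂} {h} u

  n₁ n₂ : ℕ
  n₁ = size h₁
  n₂ = size h₂

  size-h : size h ≡ n₁ + n₂
  size-h = size-union {h₁} {h₂} {h} u

  -- Equalities do not depend on the heap.
  eq-group : ∀ {x y} a b → Pol a (s x ≡ s y) →
             All (Sat s h₁) (eqLits a b x y) ⇔ Pol b (s x ≡ s y)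
  eq-group {x} {y} a b eqφ = mk⇔
    (λ { (_ ∷ eqψ ∷ []) → to (lit⇔ {s} {h₁} b (ceq x y)) eqψ })
    (λ eqψ → from (lit⇔ {s} {h₁} a (ceq x y)) eqφ ∷ from (lit⇔ {s} {h₁} b (ceq x y)) eqψ ∷ [])

  -- x is allocated in h iff it is allocated in exactly one of h₁, h₂.
  alloc-group : ∀ {x} a b → Pol a (Allocated h₂ (s x)) →
                All (Sat s h₁) (allocLits a b x) ⇔ Pol b (Allocated h (s x))
  alloc-group {x} true true a₂ = mk⇔
    (λ _ → allocatedRight a₂)
    (λ _ → (λ a₁ → alloc-sound {s} {h₁} x a₁ (disjointRight a₂)) ∷ [])
  alloc-group true false a₂ = mk⇔
    (λ { (_ ∷ _ ∷ absurd ∷ []) → ⊥-elim (absurd refl) })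
    (λ ¬a → ⊥-elim (¬a (allocatedRight a₂)))
  alloc-group {x} false true ¬a₂ = mk⇔
    (λ { (a₁ ∷ []) → allocatedLeft (alloc-sound {s} {h₁} x a₁) })
    (λ a → alloc-complete {s} {h₁} x (λ f₁ → a (freeBoth f₁ (¬allocated⇒free {h₂} ¬a₂))) ∷ [])
  alloc-group {x} false false ¬a₂ = mk⇔
    (λ { (¬a₁ ∷ []) a → a (freeBoth (¬allocated⇒free {h₁} (¬a₁ ∘ alloc-complete {s} {h₁} x))
                                    (¬allocated⇒free {h₂} ¬a₂)) })
    (λ ¬a → (λ a₁ → ¬a (allocatedLeft (alloc-sound {s} {h₁} x a₁))) ∷ [])

  -- The contents of x in h come from h₂ if h₂ allocates x, else from h₁.
  pto-group : ∀ {x y} a p q → Pol a (Allocated h₂ (s x)) → Pol p (fn h₂ (s x) ≡ just (s y)) →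
              All (Sat s h₁) (ptoLits a p q x y) ⇔ Pol q (fn h (s x) ≡ just (s y))
  pto-group true  true  true  _  p₂  = mk⇔ (λ _ → fromRight p₂) (λ _ → [])
  pto-group true  false true  a₂ ¬p₂ = mk⇔
    (λ { (absurd ∷ []) → ⊥-elim (absurd refl) })
    (λ p → ⊥-elim (¬p₂ (viaRight a₂ p)))
  pto-group true  true  false _  p₂  = mk⇔
    (λ { (_ ∷ absurd ∷ []) → ⊥-elim (absurd refl) })
    (λ ¬p → ⊥-elim (¬p (fromRight p₂)))
  pto-group true  false false a₂ ¬p₂ = mk⇔
    (λ _ p → ¬p₂ (viaRight a₂ p))
    (λ ¬p → (¬p ∘ fromLeft) ∷ [])
  pto-group false true  true  ¬a₂ p₂ = mk⇔
    (λ _ → fromRight p₂)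
    (λ _ → ⊥-elim (¬a₂ (just-allocated {h₂} p₂)))
  pto-group false false true  ¬a₂ _  = mk⇔
    (λ { (p₁ ∷ []) → fromLeft p₁ })
    (λ p → viaLeft ¬a₂ p ∷ [])
  pto-group false true  false ¬a₂ p₂ = mk⇔
    (λ { (_ ∷ absurd ∷ []) → ⊥-elim (absurd refl) })
    (λ _ → ⊥-elim (¬a₂ (just-allocated {h₂} p₂)))
  pto-group false false false ¬a₂ _  = mk⇔
    (λ { (¬p₁ ∷ []) p → ¬p₁ (viaLeft ¬a₂ p) })
    (λ ¬p → (¬p ∘ fromLeft) ∷ [])

  size-lower : ∀ {β₁ β₂} a → Pol a (β₁ ≤ n₂) → ¬ β₁ ≤ n₂ →
               All (Sat s h₁) (sizeLits a true β₁ β₂) → β₂ + 1 ∸ β₁ ≤ n₁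
  size-lower true  β₁≤n₂ β₁≰n₂ _        = ⊥-elim (β₁≰n₂ β₁≤n₂)
  size-lower false _     _     (q ∷ []) = size-sound {s} {h₁} _ q

  size-upper : ∀ {β₁ β₂} a → Pol a (β₁ ≤ n₂) → β₁ ≤ n₂ →
               All (Sat s h₁) (sizeLits a false β₁ β₂) → ¬ β₂ ∸ β₁ ≤ n₁
  size-upper true  _     _     (q ∷ []) = q ∘ size-complete {s} {h₁} _
  size-upper false β₁≰n₂ β₁≤n₂ _        = ⊥-elim (β₁≰n₂ β₁≤n₂)

  -- A size literal of ψ is determined by the size groups for all β₁ ≤ α: use
  -- β₁ = n₂ + 1 (or α ≤ n₂) for a lower bound and β₁ = n₂ (or α) for an upper one.
  size-extend : ∀ {α β₂} (a : ℕ → Bool) b → β₂ ≤ α →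
                (∀ {β₁} → β₁ ≤ α → Pol (a β₁) (β₁ ≤ n₂)) →
                (∀ {β₁} → β₁ ≤ α → All (Sat s h₁) (sizeLits (a β₁) b β₁ β₂)) →
                Pol b (β₂ ≤ size h)
  size-extend {α} {β₂} a true β₂≤α sizeφ box = subst (β₂ ≤_) (sym size-h) β₂≤n
    where
    β₂≤n : β₂ ≤ n₁ + n₂
    β₂≤n with α ≤? n₂
    ... | yes α≤n₂ = ≤-trans β₂≤α (≤-trans α≤n₂ (m≤n+m n₂ n₁))
    ... | no α≰n₂ =
      split-≤ ≤-refl (subst (_≤ n₁) (cong (_∸ suc n₂) (+-comm β₂ 1))
                                   (size-lower {β₂ = β₂} (a (suc n₂)) (sizeφ n₂<α) (n≮n n₂) (box n₂<α)))
      where n₂<α = ≰⇒> α≰n₂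
  size-extend {α} {β₂} a false β₂≤α sizeφ box β₂≤size with n₂ ≤? α
  ... | yes n₂≤α = size-upper (a n₂) (sizeφ n₂≤α) ≤-refl (box n₂≤α)
                     (m≤n+o⇒m∸n≤o β₂ n₂ (subst (β₂ ≤_) (trans size-h (+-comm n₁ n₂)) β₂≤size))
  ... | no n₂≰α  = size-upper (a α) (sizeφ ≤-refl) (<⇒≤ (≰⇒> n₂≰α)) (box ≤-refl)
                     (subst (_≤ n₁) (sym (m≤n⇒m∸n≡0 β₂≤α)) z≤n)

  size-restrict : ∀ {β₁ β₂} a b → Pol a (β₁ ≤ n₂) → Pol b (β₂ ≤ size h) →
                  All (Sat s h₁) (sizeLits a b β₁ β₂)
  size-restrict true  true  _     _     = []
  size-restrict false false _     _     = []
  size-restrict {β₁} {β₂} false true  β₁≰n₂ β₂≤size =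
    size-complete {s} {h₁} _ (deficit-≤ (≰⇒> β₁≰n₂) (subst (β₂ ≤_) size-h β₂≤size)) ∷ []
  size-restrict {β₁} {β₂} true  false β₁≤n₂ β₂≰size =
    (λ q → β₂≰size (subst (β₂ ≤_) (sym size-h) (split-≤ β₁≤n₂ (size-sound {s} {h₁} _ q)))) ∷ []

  box⇔type : ∀ X α φ ψ → TypeHolds X α φ s h₂ →
             BoxHolds X α φ ψ s h₁ ⇔ TypeHolds X α ψ s h
  box⇔type X α φ ψ tφ = mk⇔ extend restrict
    where
    module Tφ = CoreWise tφ

    extend : BoxHolds X α φ ψ s h₁ → TypeHolds X α ψ s h
    extend bh = record
      { atEq    = λ x∈ y∈ → to (eq-group _ _ (Tφ.atEq x∈ y∈)) (eqBox x∈ y∈)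
      ; atAlloc = λ x∈ → to (alloc-group _ _ (Tφ.atAlloc x∈)) (allocBox x∈)
      ; atPto   = λ x∈ y∈ → to (pto-group _ _ _ (Tφ.atAlloc x∈) (Tφ.atPto x∈ y∈)) (ptoBox x∈ y∈)
      ; atSize  = λ β₂≤α → size-extend (λ β → φ (csize β)) _ β₂≤α Tφ.atSize (λ β₁≤α → sizeBox β₁≤α β₂≤α)
      }
      where open BoxHolds bh

    restrict : TypeHolds X α ψ s h → BoxHolds X α φ ψ s h₁
    restrict tψ = record
      { eqBox    = λ x∈ y∈ → from (eq-group _ _ (Tφ.atEq x∈ y∈)) (Tψ.atEq x∈ y∈)
      ; allocBox = λ x∈ → from (alloc-group _ _ (Tφ.atAlloc x∈)) (Tψ.atAlloc x∈)
      ; ptoBox   = λ x∈ y∈ → from (pto-group _ _ _ (Tφ.atAlloc x∈) (Tφ.atPto x∈ y∈)) (Tψ.atPto x∈ y∈)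
      ; sizeBox  = λ β₁≤α β₂≤α → size-restrict _ _ (Tφ.atSize β₁≤α) (Tψ.atSize β₂≤α)
      }
      where module Tψ = CoreWise tψ

box⇔ψ : ∀ X α φ ψ s {h₁ h₂ h} → Union h₁ h₂ h → s , h₂ ⊨ typeForm X α φ →
        s , h₁ ⊨ Box⊛ X α φ ψ ⇔ s , h ⊨ typeForm X α ψ
box⇔ψ X α φ ψ s {h₁} {h₂} {h} u h₂⊨φ = mk⇔
  (from (typeForm⇔ X α ψ s h) ∘ to extension ∘ to (Box⊛⇔ X α φ ψ s h₁))
  (from (Box⊛⇔ X α φ ψ s h₁) ∘ from extension ∘ to (typeForm⇔ X α ψ s h))
  where
  extension = Extension.box⇔type s u X α φ ψ (to (typeForm⇔ X α φ s h₂) h₂⊨φ)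

lemma6p4 : (X : List PVAR) → Unique X → (α : ℕ) → length X ≤ α →
    (φ ψ : TypeChoice) →
    Satisfiable (typeForm X α φ) → Satisfiable (typeForm X α ψ) →
    Valid ((Box⊛ X α φ ψ ∗ typeForm X α φ) ⇒ typeForm X α ψ)
    × Valid (((¬ᶠ Box⊛ X α φ ψ) ∗ typeForm X α φ) ⇒ (¬ᶠ typeForm X α ψ))
lemma6p4 X _ α _ φ ψ _ _ = boxForcesψ , ¬boxForces¬ψ
  where
  boxForcesψ : Valid ((Box⊛ X α φ ψ ∗ typeForm X α φ) ⇒ typeForm X α ψ)
  boxForcesψ s h ((h₁ , h₂ , u , box , h₂⊨φ) , h⊭ψ) =
    h⊭ψ (to (box⇔ψ X α φ ψ s u h₂⊨φ) box)
  ¬boxForces¬ψ : Valid (((¬ᶠ Box⊛ X α φ ψ) ∗ typeForm X α φ) ⇒ (¬ᶠ typeForm X α ψ))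
  ¬boxForces¬ψ s h ((h₁ , h₂ , u , ¬box , h₂⊨φ) , ¬h⊭ψ) =
    ¬h⊭ψ (¬box ∘ from (box⇔ψ X α φ ψ s u h₂⊨φ))
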